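{- Let $G_0,G_1\in\mathbb{Z}$ with $\gcd(G_0,G_1)=1$, and let $(G_n)_{n\ge0}$ satisfy $G_n=G_{n-1}+G_{n-2}$ for $n\ge2$. If $k$ is a positive integer with $k\equiv 1,5,7,11\pmod{12}$ and $\pi_{G_0,G_1}(m)$ is even for all integers $m>2$, then $\mathcal{G}_{G_0,G_1}(k)=1$. In particular, for such $k$, $\mathcal{F}(k)=1$, $\mathcal{L}(k)=1$, and $\mathcal{G}_{G_0,G_1}(k)=1$ whenever $G_1^2-G_0G_1-G_0^2=\pm1$.
   Context: For a positive integer $k$, $\mathcal{G}_{G_0,G_1}(k)$ is the greatest common divisor of all integers $\sum_{i=0}^{k-1}G_{n+i}$, $n\ge1$; $\mathcal{F}(k)$ and $\mathcal{L}(k)$ denote this quantity for the Fibonacci sequence ($G_0=0,G_1=1$) and the Lucas sequence ($G_0=2,G_1=1$). For $m\ge2$, $\pi_{G_0,G_1}(m)$ is the smallest positive integer $r$ with $G_r\equiv G_0$ and $G_{r+1}\equiv G_1 \pmod m$. -}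

module Defs where

open import Data.Nat as ℕ using (ℕ; zero; suc)
open import Data.Integer as ℤ using (ℤ; +_)
open import Data.Integer.Divisibility using (_∣_)
open import Data.Product using (Σ; _×_)
open import Relation.Nullary using (¬_)

G : ℤ → ℤ → ℕ → ℤ
G G₀ G₁ zero = G₀
G G₀ G₁ (suc zero) = G₁
G G₀ G₁ (suc (suc n)) = G G₀ G₁ (suc n) ℤ.+ G G₀ G₁ n

sumFrom : ℤ → ℤ → ℕ → ℕ → ℤ
sumFrom G₀ G₁ n zero = + 0
sumFrom G₀ G₁ n (suc k) = G G₀ G₁ n ℤ.+ sumFrom G₀ G₁ (suc n) k

_≡_[mod_] : ℤ → ℤ → ℕ → Set
a ≡ b [mod m ] = (+ m) ∣ (a ℤ.- b)

IsSumGCD : ℤ → ℤ → ℕ → ℕ → Set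
IsSumGCD G₀ G₁ k d =
  ((n : ℕ) → 1 ℕ.≤ n → (+ d) ∣ sumFrom G₀ G₁ n k)
  × ((e : ℤ) → ((n : ℕ) → 1 ℕ.≤ n → e ∣ sumFrom G₀ G₁ n k) → e ∣ (+ d))

IsPeriod : ℤ → ℤ → ℕ → ℕ → Set
IsPeriod G₀ G₁ m r =
  (G G₀ G₁ r ≡ G₀ [mod m ]) × (G G₀ G₁ (suc r) ≡ G₁ [mod m ])

IsPisano : ℤ → ℤ → ℕ → ℕ → Set
IsPisano G₀ G₁ m r =
  1 ℕ.≤ r × IsPeriod G₀ G₁ m r
  × ((s : ℕ) → 1 ℕ.≤ s → s ℕ.< r → ¬ IsPeriod G₀ G₁ m s)

PisanoEven : ℤ → ℤ → ℕ → Set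
PisanoEven G₀ G₁ m = Σ ℕ (λ r → IsPisano G₀ G₁ m r × (2 ℕ.∣ r))
  where import Data.Nat.Divisibility as ℕ

-- If e divides every sum of k consecutive terms, then, as such a sum is G(n+k+1) − G(n+1),
-- the sequence is k-periodic modulo e. For odd k, Cassini's identity turns the congruences
-- G(k) ≡ G₀, G(k+1) ≡ G₁ into e ∣ L(k)·G₀ and e ∣ L(k)·G₁, so e ∣ L(k), which is odd since
-- 3 ∤ k. It remains to see e ∣ 2: a period modulo |e| > 2 would be a multiple of the even
-- Pisano period; for G₁² − G₀G₁ − G₀² = ±1 this norm changes sign at each step yet is
-- preserved modulo e by the period; and for the Lucas numbers L(k) ≡ L(0) = 2.
module Submission where

open import Defs
open import Data.Nat using (ℕ; _≤_; _<_; _%_)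
open import Data.Integer using (ℤ; +_; -_; _*_; _-_)
open import Data.Integer.GCD using (gcd)
open import Data.Product using (_×_)
open import Data.Sum using (_⊎_)
open import Relation.Binary.PropositionalEquality using (_≡_)

open import Data.Nat as ℕ using (zero; suc; s≤s; z≤n; NonZero)
open import Data.Nat.DivMod using (_/_; m≡m%n+[m/n]*n; m%n<n; m∣n⇒o%n%m≡o%m)
import Data.Nat.Divisibility as ℕ
import Data.Nat.GCD as ℕ
import Data.Nat.Properties as ℕ
open import Data.Integer using (_+_; ∣_∣)
open import Data.Integer.Properties using (abs-*; neg-involutive; ∣i∣≡0⇒i≡0; +-identityʳ)
import Data.Integer.Divisibility as Unsigned
open import Data.Integer.Divisibility.Signed
open import Data.Integer.GCD using (gcd[i,j]∣i; gcd[i,j]∣j)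
open import Data.Integer.Tactic.RingSolver using (solve-∀)
open import Data.Product using (∃-syntax; _,_; proj₁; proj₂)
open import Data.Sum using (inj₁; inj₂; [_,_]′; map)
open import Data.Empty using (⊥-elim)
open import Function using (_∘_)
open import Relation.Nullary using (¬_)
open import Relation.Binary.PropositionalEquality
  using (refl; sym; trans; cong; cong₂; subst; module ≡-Reasoning)

F : ℕ → ℤ
F = G (+ 0) (+ 1)

L : ℕ → ℤ
L = G (+ 2) (+ 1)

Odd : ℤ → Set
Odd x = ∃[ w ] x ≡ + 1 + w * + 2

∣odd∧∣2⇒∣1 : ∀ {e x} → e ∣ x → Odd x → e ∣ + 2 → e ∣ + 1
∣odd∧∣2⇒∣1 {e} {x} e∣x (w , x≡1+2w) e∣2 =
  subst (e ∣_) (trans (cong (_- w * + 2) x≡1+2w) (cancel w)) (∣m∣n⇒∣m-n e∣x (∣n⇒∣m*n w e∣2))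
  where
  cancel : ∀ w → (+ 1 + w * + 2) - w * + 2 ≡ + 1
  cancel = solve-∀

∣m*i∧∣m*j⇒∣m : ∀ {e} m {i j} → gcd i j ≡ + 1 → e ∣ m * i → e ∣ m * j → e ∣ m
∣m*i∧∣m*j⇒∣m {e} m {i} {j} gcd≡1 e∣mi e∣mj =
  ∣ᵤ⇒∣ (subst (∣ e ∣ ℕ.∣_) gcd[mi,mj]≡m (ℕ.gcd-greatest (∣abs e∣mi) (∣abs e∣mj)))
  where
  ∣abs : ∀ {k} → e ∣ m * k → ∣ e ∣ ℕ.∣ ∣ m ∣ ℕ.* ∣ k ∣
  ∣abs {k} e∣mk = subst (∣ e ∣ ℕ.∣_) (abs-* m k) (∣⇒∣ᵤ e∣mk)
  open ≡-Reasoning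
  gcd[mi,mj]≡m : ℕ.gcd (∣ m ∣ ℕ.* ∣ i ∣) (∣ m ∣ ℕ.* ∣ j ∣) ≡ ∣ m ∣
  gcd[mi,mj]≡m = begin
    ℕ.gcd (∣ m ∣ ℕ.* ∣ i ∣) (∣ m ∣ ℕ.* ∣ j ∣) ≡⟨ sym (ℕ.c*gcd[m,n]≡gcd[cm,cn] (∣ m ∣) (∣ i ∣) (∣ j ∣)) ⟩
    ∣ m ∣ ℕ.* ℕ.gcd ∣ i ∣ ∣ j ∣                ≡⟨ cong (λ d → ∣ m ∣ ℕ.* ∣ d ∣) gcd≡1 ⟩
    ∣ m ∣ ℕ.* 1                                ≡⟨ ℕ.*-identityʳ ∣ m ∣ ⟩
    ∣ m ∣                                      ∎

-- δ = det (M − I) for M = [[a,b],[c,d]]; multiply the two congruences by the adjugate of M − I.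
∣-det[M-I]* : ∀ {e} a b c d x y → let δ = (a - + 1) * (d - + 1) - b * c in
  e ∣ (a * x + b * y) - x → e ∣ (c * x + d * y) - y → (e ∣ δ * x) × (e ∣ δ * y)
∣-det[M-I]* {e} a b c d x y e∣u e∣v =
  subst (e ∣_) (adj₁ a b c d x y) (∣m∣n⇒∣m-n (∣n⇒∣m*n (d - + 1) e∣u) (∣n⇒∣m*n b e∣v)) ,
  subst (e ∣_) (adj₂ a b c d x y) (∣m∣n⇒∣m-n (∣n⇒∣m*n (a - + 1) e∣v) (∣n⇒∣m*n c e∣u))
  where
  adj₁ : ∀ a b c d x y → (d - + 1) * ((a * x + b * y) - x) - b * ((c * x + d * y) - y)
                         ≡ ((a - + 1) * (d - + 1) - b * c) * x
  adj₁ = solve-∀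
  adj₂ : ∀ a b c d x y → (a - + 1) * ((c * x + d * y) - y) - c * ((a * x + b * y) - x)
                         ≡ ((a - + 1) * (d - + 1) - b * c) * y
  adj₂ = solve-∀

m%n≡r⇒m≡r+[m/n]*n : ∀ m n .{{_ : NonZero n}} {r} → m % n ≡ r → m ≡ r ℕ.+ (m / n) ℕ.* n
m%n≡r⇒m≡r+[m/n]*n m n m%n≡r = trans (m≡m%n+[m/n]*n m n) (cong (ℕ._+ (m / n) ℕ.* n) m%n≡r)

module Sequence (G₀ G₁ : ℤ) where

  g : ℕ → ℤ
  g = G G₀ G₁

  g-suc≡F*G₀+F*G₁ : ∀ j → g (suc j) ≡ F j * G₀ + F (suc j) * G₁
  g-suc≡F*G₀+F*G₁ zero = base₁ G₀ G₁
    where base₁ : ∀ x y → y ≡ + 0 * x + + 1 * y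
          base₁ = solve-∀
  g-suc≡F*G₀+F*G₁ (suc zero) = base₂ G₀ G₁
    where base₂ : ∀ x y → y + x ≡ + 1 * x + (+ 1 + + 0) * y
          base₂ = solve-∀
  g-suc≡F*G₀+F*G₁ (suc (suc j)) =
    trans (cong₂ _+_ (g-suc≡F*G₀+F*G₁ (suc j)) (g-suc≡F*G₀+F*G₁ j))
          (collect (F (suc j)) (F (suc (suc j))) (F j) (F (suc j)) G₀ G₁)
    where collect : ∀ a b c d x y → (a * x + b * y) + (c * x + d * y) ≡ (a + c) * x + (b + d) * y
          collect = solve-∀

  sumFrom≡g-g : ∀ n k → sumFrom G₀ G₁ n k ≡ g (suc n ℕ.+ k) - g (suc n)
  sumFrom≡g-g n zero rewrite ℕ.+-identityʳ n = x≡x-x (g (suc n))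
    where x≡x-x : ∀ x → + 0 ≡ x - x
          x≡x-x = solve-∀
  sumFrom≡g-g n (suc k) rewrite ℕ.+-suc n k =
    trans (cong (λ s → g n + s) (sumFrom≡g-g (suc n) k))
          (telescope (g n) (g (suc (suc (n ℕ.+ k)))) (g (suc n)))
    where telescope : ∀ a b c → a + (b - (c + a)) ≡ b - c
          telescope = solve-∀

  g-3+-odd : ∀ n → Odd (g n) → Odd (g (3 ℕ.+ n))
  g-3+-odd n (w , g≡1+2w) = g (suc n) + w ,
    trans (cong (λ x → (g (suc n) + x) + g (suc n)) g≡1+2w) (regroup (g (suc n)) w)
    where regroup : ∀ a w → (a + (+ 1 + w * + 2)) + a ≡ + 1 + (a + w) * + 2
          regroup = solve-∀

  norm : ℕ → ℤ
  norm n = g (suc n) * g (suc n) - g n * g (suc n) - g n * g n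

  norm-suc : ∀ n → norm (suc n) ≡ - norm n
  norm-suc n = flip (g (suc n)) (g n)
    where flip : ∀ x y → (x + y) * (x + y) - x * (x + y) - x * x ≡ - (x * x - y * x - y * y)
          flip = solve-∀

  norm-even : ∀ t → norm (t ℕ.* 2) ≡ norm 0
  norm-even zero = refl
  norm-even (suc t) = begin
    norm (suc (suc (t ℕ.* 2))) ≡⟨ norm-suc (suc (t ℕ.* 2)) ⟩
    - norm (suc (t ℕ.* 2))     ≡⟨ cong -_ (norm-suc (t ℕ.* 2)) ⟩
    - - norm (t ℕ.* 2)         ≡⟨ neg-involutive _ ⟩
    norm (t ℕ.* 2)             ≡⟨ norm-even t ⟩
    norm 0                     ∎
    where open ≡-Reasoning

  Δ : ℕ → ℕ → ℤ
  Δ p n = g (n ℕ.+ p) - g n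

  Δ-rec : ∀ p n → Δ p (suc (suc n)) ≡ Δ p (suc n) + Δ p n
  Δ-rec p n = interchange (g (suc (n ℕ.+ p))) (g (n ℕ.+ p)) (g (suc n)) (g n)
    where interchange : ∀ a b c d → (a + b) - (c + d) ≡ (a - c) + (b - d)
          interchange = solve-∀

  Periodic : ℤ → ℕ → Set
  Periodic d p = ∀ n → d ∣ Δ p n

  periodic-from-initial : ∀ {d} p → d ∣ Δ p 0 → d ∣ Δ p 1 → Periodic d p
  periodic-from-initial p d∣Δ₀ d∣Δ₁ zero = d∣Δ₀
  periodic-from-initial p d∣Δ₀ d∣Δ₁ (suc zero) = d∣Δ₁
  periodic-from-initial {d} p d∣Δ₀ d∣Δ₁ (suc (suc n)) =
    subst (d ∣_) (sym (Δ-rec p n))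
      (∣m∣n⇒∣m+n (periodic-from-initial p d∣Δ₀ d∣Δ₁ (suc n)) (periodic-from-initial p d∣Δ₀ d∣Δ₁ n))

  periodic-∣ : ∀ {d e p} → d ∣ e → Periodic e p → Periodic d p
  periodic-∣ d∣e per n = ∣-trans d∣e (per n)

  periodic-zero : ∀ {d} → Periodic d 0
  periodic-zero {d} n rewrite ℕ.+-identityʳ n =
    subst (d ∣_) (x≡x-x (g n)) (∣ᵤ⇒∣ (∣ d ∣ ℕ.∣0))
    where x≡x-x : ∀ x → + 0 ≡ x - x
          x≡x-x = solve-∀

  periodic-+ : ∀ {d a b} → Periodic d a → Periodic d b → Periodic d (a ℕ.+ b)
  periodic-+ {d} {a} {b} per-a per-b n =
    subst (d ∣_) (trans (telescope (g ((n ℕ.+ a) ℕ.+ b)) (g (n ℕ.+ a)) (g n))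
                        (cong (λ i → g i - g n) (ℕ.+-assoc n a b)))
      (∣m∣n⇒∣m+n (per-b (n ℕ.+ a)) (per-a n))
    where telescope : ∀ x y z → (x - y) + (y - z) ≡ x - z
          telescope = solve-∀

  periodic-cancel : ∀ {d a b} → Periodic d (a ℕ.+ b) → Periodic d b → Periodic d a
  periodic-cancel {d} {a} {b} per-ab per-b n =
    subst (d ∣_) (difference (g (n ℕ.+ (a ℕ.+ b))) (g (n ℕ.+ a)) (g n))
      (∣m∣n⇒∣m-n (per-ab n) (subst (λ i → d ∣ g i - g (n ℕ.+ a)) (ℕ.+-assoc n a b) (per-b (n ℕ.+ a))))
    where difference : ∀ x y z → (x - z) - (x - y) ≡ y - z
          difference = solve-∀

  periodic-* : ∀ {d r} → Periodic d r → ∀ q → Periodic d (q ℕ.* r)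
  periodic-* per zero = periodic-zero
  periodic-* per (suc q) = periodic-+ per (periodic-* per q)

  isPeriod⇒periodic : ∀ {m r} → IsPeriod G₀ G₁ m r → Periodic (+ m) r
  isPeriod⇒periodic {r = r} (m∣Δ₀ , m∣Δ₁) = periodic-from-initial r (∣ᵤ⇒∣ m∣Δ₀) (∣ᵤ⇒∣ m∣Δ₁)

  pisano∣period : ∀ {m r p} → IsPisano G₀ G₁ m r → Periodic (+ m) p → r ℕ.∣ p
  pisano∣period {m} {r@(suc _)} {p} (_ , period-r , minimal) per-p =
    ℕ.m%n≡0⇒n∣m p r (remainder≡0 (p % r) (m%n<n p r) per-remainder)
    where
    per-remainder : Periodic (+ m) (p % r)
    per-remainder = periodic-cancel (subst (Periodic (+ m)) (m≡m%n+[m/n]*n p r) per-p)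
                                    (periodic-* (isPeriod⇒periodic period-r) (p / r))
    remainder≡0 : ∀ s → s < r → Periodic (+ m) s → s ≡ 0
    remainder≡0 zero _ _ = refl
    remainder≡0 (suc s) s<r per-s = ⊥-elim (minimal (suc s) (s≤s z≤n) s<r (∣⇒∣ᵤ (per-s 0) , ∣⇒∣ᵤ (per-s 1)))

  sums⇒periodic : ∀ {e} k → ((n : ℕ) → 1 ≤ n → e Unsigned.∣ sumFrom G₀ G₁ n k) → Periodic e k
  sums⇒periodic {e} k e∣S = periodic-from-initial k e∣Δ₀ e∣Δ₁
    where
    e∣Δ₂₊ : ∀ n → e ∣ Δ k (suc (suc n))
    e∣Δ₂₊ n = subst (e ∣_) (sumFrom≡g-g (suc n) k) (∣ᵤ⇒∣ (e∣S (suc n) (s≤s z≤n)))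
    e∣Δ₁ : e ∣ Δ k 1
    e∣Δ₁ = ∣m+n∣m⇒∣n (subst (e ∣_) (Δ-rec k 1) (e∣Δ₂₊ 1)) (e∣Δ₂₊ 0)
    e∣Δ₀ : e ∣ Δ k 0
    e∣Δ₀ = ∣m+n∣m⇒∣n (subst (e ∣_) (Δ-rec k 0) (e∣Δ₂₊ 0)) e∣Δ₁

  sumGCD≡1 : ∀ k → (∀ e → Periodic e k → e ∣ + 1) → IsSumGCD G₀ G₁ k 1
  sumGCD≡1 k only-units = (λ n _ → ℕ.1∣ _) , λ e e∣S → ∣⇒∣ᵤ (only-units e (sums⇒periodic k e∣S))

  periodic⇒∣norm-norm : ∀ {e k} → Periodic e k → e ∣ norm k - norm 0
  periodic⇒∣norm-norm {e} {k} per =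
    subst (e ∣_) (sym (factor G₁ G₀ (g (suc k)) (g k)))
      (∣m∣n⇒∣m-n (∣m⇒∣m*n _ (per 1)) (∣m⇒∣m*n _ (per 0)))
    where factor : ∀ x y x′ y′ → (x′ * x′ - y′ * x′ - y′ * y′) - (x * x - y * x - y * y)
                                 ≡ (x′ - x) * (x + x′ - y) - (y′ - y) * (x′ + y + y′)
          factor = solve-∀

  norm-odd : ∀ k → k % 2 ≡ 1 → norm k ≡ - norm 0
  norm-odd k k%2≡1 = subst (λ i → norm i ≡ - norm 0) (sym (m%n≡r⇒m≡r+[m/n]*n k 2 k%2≡1))
                       (trans (norm-suc (k / 2 ℕ.* 2)) (cong -_ (norm-even (k / 2))))

open Sequence using (g-suc≡F*G₀+F*G₁; g-3+-odd; norm; norm-even; norm-odd; Periodic; periodic-∣;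
                     pisano∣period; sumGCD≡1; periodic⇒∣norm-norm)

L-suc≡F+F : ∀ j → L (suc j) ≡ F j + F (suc (suc j))
L-suc≡F+F j = trans (g-suc≡F*G₀+F*G₁ (+ 2) (+ 1) j) (regroup (F j) (F (suc j)))
  where regroup : ∀ p q → p * + 2 + q * + 1 ≡ p + (q + p)
        regroup = solve-∀

L-odd : ∀ n → n % 3 ≡ 1 ⊎ n % 3 ≡ 2 → Odd (L n)
L-odd n n%3≢0 = [ at (λ s → proj₁ (L[1,2+3s]-odd s)) , at (λ s → proj₂ (L[1,2+3s]-odd s)) ]′ n%3≢0
  where
  L[1,2+3s]-odd : ∀ s → Odd (L (1 ℕ.+ s ℕ.* 3)) × Odd (L (2 ℕ.+ s ℕ.* 3))
  L[1,2+3s]-odd zero = (+ 0 , refl) , (+ 1 , refl)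
  L[1,2+3s]-odd (suc s) = g-3+-odd (+ 2) (+ 1) (1 ℕ.+ s ℕ.* 3) (proj₁ (L[1,2+3s]-odd s)) ,
                    g-3+-odd (+ 2) (+ 1) (2 ℕ.+ s ℕ.* 3) (proj₂ (L[1,2+3s]-odd s))
  at : ∀ {i} → (∀ s → Odd (L (i ℕ.+ s ℕ.* 3))) → n % 3 ≡ i → Odd (L n)
  at odd n%3≡i = subst (Odd ∘ L) (sym (m%n≡r⇒m≡r+[m/n]*n n 3 n%3≡i)) (odd (n / 3))

-- Cassini's identity F(j+2) F(j) − F(j+1)² = −1 (j even) turns det (M − I) into −L(j+1).
F-det[M-I]≡-L : ∀ t → let j = t ℕ.* 2 in
  (F j - + 1) * (F (suc (suc j)) - + 1) - F (suc j) * F (suc j) ≡ - L (suc j)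
F-det[M-I]≡-L t = begin
  (p - + 1) * ((q + p) - + 1) - q * q ≡⟨ expand p q ⟩
  - ℓ + (+ 1 - norm (+ 0) (+ 1) j)    ≡⟨ cong (λ x → - ℓ + (+ 1 - x)) (norm-even (+ 0) (+ 1) t) ⟩
  - ℓ + + 0                           ≡⟨ +-identityʳ (- ℓ) ⟩
  - ℓ                                 ≡⟨ cong -_ (sym (L-suc≡F+F j)) ⟩
  - L (suc j)                         ∎
  where
  open ≡-Reasoning
  j = t ℕ.* 2
  p = F j
  q = F (suc j)
  ℓ = p + (q + p)
  expand : ∀ p q → (p - + 1) * ((q + p) - + 1) - q * q
                   ≡ - (p + (q + p)) + (+ 1 - (q * q - p * q - p * p))
  expand = solve-∀

periodic⇒∣L : ∀ {G₀ G₁ e} k → k % 2 ≡ 1 → gcd G₀ G₁ ≡ + 1 → Periodic G₀ G₁ e k → e ∣ L k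
periodic⇒∣L {G₀} {G₁} {e} k k%2≡1 coprime per =
  subst (λ i → e ∣ L i) (sym k≡) (∣L-at (k / 2) (subst (Periodic G₀ G₁ e) k≡ per))
  where
  k≡ : k ≡ suc (k / 2 ℕ.* 2)
  k≡ = m%n≡r⇒m≡r+[m/n]*n k 2 k%2≡1
  ∣L-at : ∀ t → Periodic G₀ G₁ e (suc (t ℕ.* 2)) → e ∣ L (suc (t ℕ.* 2))
  ∣L-at t per′ = subst (e ∣_) (neg-involutive _) (∣m⇒∣-m e∣-L)
    where
    j = t ℕ.* 2
    e∣Δ₀ : e ∣ (F j * G₀ + F (suc j) * G₁) - G₀
    e∣Δ₀ = subst (λ x → e ∣ x - G₀) (g-suc≡F*G₀+F*G₁ G₀ G₁ j) (per′ 0)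
    e∣Δ₁ : e ∣ (F (suc j) * G₀ + F (suc (suc j)) * G₁) - G₁
    e∣Δ₁ = subst (λ x → e ∣ x - G₁) (g-suc≡F*G₀+F*G₁ G₀ G₁ (suc j)) (per′ 1)
    e∣δ : e ∣ (F j - + 1) * (F (suc (suc j)) - + 1) - F (suc j) * F (suc j)
    e∣δ = let e∣δG₀ , e∣δG₁ = ∣-det[M-I]* (F j) (F (suc j)) (F (suc j)) (F (suc (suc j))) G₀ G₁ e∣Δ₀ e∣Δ₁
          in ∣m*i∧∣m*j⇒∣m _ coprime e∣δG₀ e∣δG₁
    e∣-L : e ∣ - L (suc j)
    e∣-L = subst (e ∣_) (F-det[M-I]≡-L t) e∣δ

UnitMod12 : ℕ → Set
UnitMod12 k = k % 12 ≡ 1 ⊎ k % 12 ≡ 5 ⊎ k % 12 ≡ 7 ⊎ k % 12 ≡ 11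

unitMod12⇒%2≡1 : ∀ k → UnitMod12 k → k % 2 ≡ 1
unitMod12⇒%2≡1 k u = trans (sym (m∣n⇒o%n%m≡o%m 2 12 k (ℕ.divides 6 refl))) (reduce u)
  where
  reduce : UnitMod12 k → k % 12 % 2 ≡ 1
  reduce (inj₁ r) = cong (_% 2) r
  reduce (inj₂ (inj₁ r)) = cong (_% 2) r
  reduce (inj₂ (inj₂ (inj₁ r))) = cong (_% 2) r
  reduce (inj₂ (inj₂ (inj₂ r))) = cong (_% 2) r

unitMod12⇒%3≢0 : ∀ k → UnitMod12 k → k % 3 ≡ 1 ⊎ k % 3 ≡ 2
unitMod12⇒%3≢0 k u = map (trans k%3≡) (trans k%3≡) (reduce u)
  where
  k%3≡ : k % 3 ≡ k % 12 % 3
  k%3≡ = sym (m∣n⇒o%n%m≡o%m 3 12 k (ℕ.divides 4 refl))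
  reduce : UnitMod12 k → k % 12 % 3 ≡ 1 ⊎ k % 12 % 3 ≡ 2
  reduce (inj₁ r) = inj₁ (cong (_% 3) r)
  reduce (inj₂ (inj₁ r)) = inj₂ (cong (_% 3) r)
  reduce (inj₂ (inj₂ (inj₁ r))) = inj₁ (cong (_% 3) r)
  reduce (inj₂ (inj₂ (inj₂ r))) = inj₂ (cong (_% 3) r)

unitMod12⇒¬2∣ : ∀ k → UnitMod12 k → ¬ 2 ℕ.∣ k
unitMod12⇒¬2∣ k u 2∣k with trans (sym (ℕ.n∣m⇒m%n≡0 k 2 2∣k)) (unitMod12⇒%2≡1 k u)
... | ()

periodic∧∣2⇒∣1 : ∀ {G₀ G₁ e k} → UnitMod12 k → gcd G₀ G₁ ≡ + 1 → Periodic G₀ G₁ e k → e ∣ + 2 → e ∣ + 1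
periodic∧∣2⇒∣1 {k = k} u coprime per =
  ∣odd∧∣2⇒∣1 (periodic⇒∣L k (unitMod12⇒%2≡1 k u) coprime per) (L-odd k (unitMod12⇒%3≢0 k u))

_≡±1 : ℤ → Set
x ≡±1 = x ≡ + 1 ⊎ x ≡ - + 1

∣±1⇒∣1 : ∀ {e x} → x ≡±1 → e ∣ x → e ∣ + 1
∣±1⇒∣1 (inj₁ refl) e∣x = e∣x
∣±1⇒∣1 (inj₂ refl) e∣x = ∣m⇒∣-m e∣x

∣-x-x⇒∣2 : ∀ {e x} → x ≡±1 → e ∣ - x - x → e ∣ + 2
∣-x-x⇒∣2 (inj₁ refl) e∣-2 = ∣m⇒∣-m e∣-2
∣-x-x⇒∣2 (inj₂ refl) e∣2 = e∣2

norm≡±1⇒gcd≡1 : ∀ G₀ G₁ → norm G₀ G₁ 0 ≡±1 → gcd G₀ G₁ ≡ + 1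
norm≡±1⇒gcd≡1 G₀ G₁ ±1 = cong +_ (ℕ.∣1⇒≡1 (∣⇒∣ᵤ (∣±1⇒∣1 ±1 d∣norm)))
  where
  d = gcd G₀ G₁
  d∣G₀ : d ∣ G₀
  d∣G₀ = ∣ᵤ⇒∣ (gcd[i,j]∣i G₀ G₁)
  d∣G₁ : d ∣ G₁
  d∣G₁ = ∣ᵤ⇒∣ (gcd[i,j]∣j G₀ G₁)
  d∣norm : d ∣ G₁ * G₁ - G₀ * G₁ - G₀ * G₀
  d∣norm = ∣m∣n⇒∣m-n (∣m∣n⇒∣m-n (∣n⇒∣m*n G₁ d∣G₁) (∣n⇒∣m*n G₀ d∣G₁)) (∣n⇒∣m*n G₀ d∣G₀)

norm≡±1⇒sumGCD≡1 : ∀ k G₀ G₁ → UnitMod12 k → norm G₀ G₁ 0 ≡±1 → IsSumGCD G₀ G₁ k 1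
norm≡±1⇒sumGCD≡1 k G₀ G₁ u ±1 = sumGCD≡1 G₀ G₁ k λ e per →
  periodic∧∣2⇒∣1 u (norm≡±1⇒gcd≡1 G₀ G₁ ±1) per
    (∣-x-x⇒∣2 ±1 (subst (λ x → e ∣ x - norm G₀ G₁ 0) (norm-odd G₀ G₁ k (unitMod12⇒%2≡1 k u))
                        (periodic⇒∣norm-norm G₀ G₁ per)))

L-sumGCD≡1 : ∀ k → UnitMod12 k → IsSumGCD (+ 2) (+ 1) k 1
L-sumGCD≡1 k u = sumGCD≡1 (+ 2) (+ 1) k λ e per →
  periodic∧∣2⇒∣1 u refl per
    (subst (e ∣_) (cancel (L k)) (∣m∣n⇒∣m-n (periodic⇒∣L k (unitMod12⇒%2≡1 k u) refl per) (per 0)))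
  where cancel : ∀ x → x - (x - + 2) ≡ + 2
        cancel = solve-∀

pisanoEven⇒sumGCD≡1 : ∀ k G₀ G₁ → UnitMod12 k → gcd G₀ G₁ ≡ + 1 →
  ((m : ℕ) → 2 < m → PisanoEven G₀ G₁ m) → IsSumGCD G₀ G₁ k 1
pisanoEven⇒sumGCD≡1 k G₀ G₁ u coprime pisanoEven = sumGCD≡1 G₀ G₁ k λ e per → by-abs e per ∣ e ∣ refl
  where
  no-period-mod : ∀ m → 2 < m → ¬ Periodic G₀ G₁ (+ m) k
  no-period-mod m 2<m per with pisanoEven m 2<m
  ... | r , pisano , 2∣r = unitMod12⇒¬2∣ k u (ℕ.∣-trans 2∣r (pisano∣period G₀ G₁ pisano per))
  by-abs : ∀ e → Periodic G₀ G₁ e k → ∀ n → ∣ e ∣ ≡ n → e ∣ + 1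
  -- e = 0 means exact periodicity, in particular periodicity modulo 3.
  by-abs e per zero |e|≡0 =
    ⊥-elim (no-period-mod 3 (s≤s (s≤s (s≤s z≤n)))
              (periodic-∣ G₀ G₁ (subst (+ 3 ∣_) (sym (∣i∣≡0⇒i≡0 |e|≡0)) (∣ᵤ⇒∣ (3 ℕ.∣0))) per))
  by-abs e per 1 |e|≡1 = ∣ᵤ⇒∣ (subst (ℕ._∣ 1) (sym |e|≡1) ℕ.∣-refl)
  by-abs e per 2 |e|≡2 = periodic∧∣2⇒∣1 u coprime per (subst (λ n → e ∣ + n) |e|≡2 m∣∣m∣)
  by-abs e per n@(suc (suc (suc _))) |e|≡n =
    ⊥-elim (no-period-mod ∣ e ∣ (subst (2 <_) (sym |e|≡n) (s≤s (s≤s (s≤s z≤n)))) (periodic-∣ G₀ G₁ ∣m∣∣m per))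

theorem5p6 :
    (k : ℕ) → 1 ≤ k →
    (k % 12 ≡ 1 ⊎ k % 12 ≡ 5 ⊎ k % 12 ≡ 7 ⊎ k % 12 ≡ 11) →
      ((G₀ G₁ : ℤ) → gcd G₀ G₁ ≡ + 1 →
        ((m : ℕ) → 2 < m → PisanoEven G₀ G₁ m) →
        IsSumGCD G₀ G₁ k 1)
      × IsSumGCD (+ 0) (+ 1) k 1
      × IsSumGCD (+ 2) (+ 1) k 1
      × ((G₀ G₁ : ℤ) →
        (G₁ * G₁ - G₀ * G₁ - G₀ * G₀ ≡ + 1 ⊎ G₁ * G₁ - G₀ * G₁ - G₀ * G₀ ≡ - (+ 1)) →
        IsSumGCD G₀ G₁ k 1)
theorem5p6 k _ u =
  (λ G₀ G₁ → pisanoEven⇒sumGCD≡1 k G₀ G₁ u) ,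
  norm≡±1⇒sumGCD≡1 k (+ 0) (+ 1) u (inj₁ refl) ,
  L-sumGCD≡1 k u ,
  (λ G₀ G₁ → norm≡±1⇒sumGCD≡1 k G₀ G₁ u)
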